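{- Let $n\geqslant 2$ and let $k$ be even with $0\leqslant k\leqslant n-1$. If the map $\phi:V(\text{CQ}_n)\to V(\text{CQ}_n)$, $\phi(u)=f_k(u)$, is an automorphism of $\text{CQ}_n$, then $k\in\{n-2,n-1\}$.
   Context: Two 2-bit strings $x_2x_1$ and $y_2y_1$ are pair related, written $x_2x_1\sim y_2y_1$, iff $(x_2x_1,y_2y_1)\in\{(00,00),(10,10),(01,11),(11,01)\}$. The $n$-dimensional crossed cube $\text{CQ}_n$ has as vertices all binary strings $u=u_{n-1}\ldots u_0$ of length $n$. Two vertices $u,v$ are adjacent iff there is an index $x$ with $0\leqslant x\leqslant n-1$ such that: (1) $v_x\neq u_x$; (2) if $x$ is odd, $v_{x-1}=u_{x-1}$; (3) $v_i=u_i$ for all $i>x$; (4) $u_{2i+1}u_{2i}\sim v_{2i+1}v_{2i}$ for all $0\leqslant i\leqslant\lfloor x/2\rfloor-1$. For $0\leqslant i\leqslant n-1$, $f_i(u)$ denotes the string obtained from $u$ by negating the bit $u_i$. -}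

module Defs where

open import Data.Nat using (ℕ; suc; _+_; _*_; _<_; _/_)
open import Data.Bool using (Bool; true; false; not; if_then_else_)
open import Data.Fin using (Fin; toℕ)
open import Data.Fin.Properties using () renaming (_≟_ to _≟F_)
open import Data.Product using (Σ; ∃; _×_)
open import Relation.Nullary using (¬_; yes; no)
open import Relation.Binary.PropositionalEquality using (_≡_; _≗_)
open import Function.Definitions using (Bijective)

Even : ℕ → Set
Even k = ∃ λ m → k ≡ 2 * m

Odd : ℕ → Set
Odd k = ∃ λ m → k ≡ suc (2 * m)

-- pair relation on 2-bit strings x₂x₁ ∼ y₂y₁ (false = 0, true = 1);
-- arguments in order x₂ x₁ y₂ y₁
data PairRel : Bool → Bool → Bool → Bool → Set where
  p00 : PairRel false false false false
  p10 : PairRel true  false true  false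
  p01 : PairRel false true  true  true
  p11 : PairRel true  true  false true

-- a vertex of CQ_n : the bit string u_{n-1} … u_0, with u i = u_i
Vertex : ℕ → Set
Vertex n = Fin n → Bool

AdjAt : ∀ {n} → Vertex n → Vertex n → Fin n → Set
AdjAt {n} u v x =
    (¬ (v x ≡ u x))
  × (Odd (toℕ x) → ∀ (j : Fin n) → suc (toℕ j) ≡ toℕ x → v j ≡ u j)
  × (∀ (j : Fin n) → toℕ x < toℕ j → v j ≡ u j)
  × (∀ (i : ℕ) → i < toℕ x / 2 → ∀ (a b : Fin n) →
       toℕ a ≡ suc (2 * i) → toℕ b ≡ 2 * i →
       PairRel (u a) (u b) (v a) (v b))

Adj : ∀ {n} → Vertex n → Vertex n → Set
Adj {n} u v = ∃ λ (x : Fin n) → AdjAt u v x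

flipBit : ∀ {n} → Fin n → Vertex n → Vertex n
flipBit i u j with j ≟F i
... | yes _ = not (u j)
... | no  _ = u j

IsAutomorphism : ∀ {n} → (Vertex n → Vertex n) → Set
IsAutomorphism {n} φ =
    Bijective {A = Vertex n} _≗_ _≗_ φ
  × (∀ (u v : Vertex n) → (Adj u v → Adj (φ u) (φ v)) × (Adj (φ u) (φ v) → Adj u v))

-- Flipping an even bit k with k + 2 < n does not preserve adjacency. The zero vertex 0 is
-- adjacent to e_{k+2} (every pair below is 00, and 00 ∼ 00), but f_k maps them to e_k and
-- e_k + e_{k+2}. These differ only in bit k+2, so an edge between them must use index k+2,
-- which demands that the pair u_{k+1}u_k = 01 be related to v_{k+1}v_k = 01; yet 01 is
-- related only to 11.
module Submission where

open import Defs
open import Data.Nat using (ℕ; suc; _+_; _≤_; _<_; _∸_; _*_; _/_)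
open import Data.Nat.Properties
open import Data.Nat.DivMod using (m*n/n≡m; m/n*n≤m)
open import Data.Fin using (Fin; toℕ; fromℕ<)
open import Data.Fin.Properties using (toℕ<n; toℕ-fromℕ<) renaming (_≟_ to _≟F_)
open import Data.Bool using (true; false; not)
open import Data.Product using (_,_; proj₁; proj₂)
open import Data.Sum using (_⊎_; inj₁; inj₂)
open import Relation.Nullary using (¬_; yes; no; contradiction)
open import Relation.Binary.PropositionalEquality
  using (_≡_; _≢_; refl; sym; trans; cong; subst; subst₂; module ≡-Reasoning)

𝟎 : ∀ {n} → Vertex n
𝟎 _ = false

flipBit-self : ∀ {n} (i : Fin n) (u : Vertex n) → flipBit i u i ≡ not (u i)
flipBit-self i u with i ≟F i
... | yes _  = refl
... | no i≢i = contradiction refl i≢i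

flipBit-other : ∀ {n} (i j : Fin n) (u : Vertex n) → toℕ j ≢ toℕ i → flipBit i u j ≡ u j
flipBit-other i j u j≢i with j ≟F i
... | yes j≡i = contradiction (cong toℕ j≡i) j≢i
... | no  _   = refl

flipBit-cong : ∀ {n} (i j : Fin n) {u v : Vertex n} → v j ≡ u j → flipBit i v j ≡ flipBit i u j
flipBit-cong i j v≡u with j ≟F i
... | yes _ = cong not v≡u
... | no  _ = v≡u

[2+2m]/2≡1+m : ∀ m → suc (suc (2 * m)) / 2 ≡ suc m
[2+2m]/2≡1+m m = begin
  suc (suc (2 * m)) / 2 ≡⟨ cong (_/ 2) (sym (*-suc 2 m)) ⟩
  2 * suc m / 2         ≡⟨ cong (_/ 2) (*-comm 2 (suc m)) ⟩
  suc m * 2 / 2         ≡⟨ m*n/n≡m (suc m) 2 ⟩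
  suc m                 ∎
  where open ≡-Reasoning

i<n/2⇒1+2i<n : ∀ {i n} → i < n / 2 → suc (2 * i) < n
i<n/2⇒1+2i<n {i} {n} i<n/2 = begin
  suc (suc (2 * i)) ≡⟨ *-suc 2 i ⟨
  2 * suc i         ≤⟨ *-monoʳ-≤ 2 i<n/2 ⟩
  2 * (n / 2)       ≡⟨ *-comm 2 (n / 2) ⟩
  n / 2 * 2         ≤⟨ m/n*n≤m n 2 ⟩
  n                 ∎
  where open ≤-Reasoning

pairRel-01 : ∀ {x₂ x₁ y₂ y₁} → x₂ ≡ false → x₁ ≡ true → PairRel x₂ x₁ y₂ y₁ → y₂ ≡ true
pairRel-01 refl refl p01 = refl

adjAt-index : ∀ {n} {u v : Vertex n} (p x : Fin n) →
              (∀ j → toℕ j ≢ toℕ p → v j ≡ u j) → AdjAt u v x → toℕ x ≡ toℕ p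
adjAt-index p x agree (vx≢ux , _) with toℕ x ≟ toℕ p
... | yes x≡p = x≡p
... | no  x≢p = contradiction (agree x x≢p) vx≢ux

𝟎-adjAt-flipBit : ∀ {n} (x : Fin n) → AdjAt 𝟎 (flipBit x 𝟎) x
𝟎-adjAt-flipBit x =
    (λ e → contradiction (trans (sym (flipBit-self x 𝟎)) e) λ ())
  , (λ _ j 1+j≡x → below j (subst (toℕ j <_) 1+j≡x ≤-refl))
  , (λ j x<j → flipBit-other x j 𝟎 (>⇒≢ x<j))
  , λ i i<x/2 a b a≡1+2i b≡2i →
      let 1+2i<x = i<n/2⇒1+2i<n i<x/2 in
      subst₂ (PairRel false false)
        (sym (below a (subst (_< toℕ x) (sym a≡1+2i) 1+2i<x)))
        (sym (below b (subst (_< toℕ x) (sym b≡2i) (<-trans (n<1+n _) 1+2i<x)))) p00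
  where
  below : ∀ j → toℕ j < toℕ x → flipBit x 𝟎 j ≡ false
  below j j<x = flipBit-other x j 𝟎 (<⇒≢ j<x)

flipBit-even-¬automorphism : ∀ {n} (k : Fin n) → Even (toℕ k) → 2 + toℕ k < n →
                             ¬ IsAutomorphism (flipBit k)
flipBit-even-¬automorphism {n} k (m , k≡2m) 2+k<n (_ , preserves) =
  contradiction (trans (sym φv[a]≡false) φv[a]≡true) λ ()
  where
  p a : Fin n
  p = fromℕ< 2+k<n
  a = fromℕ< (<-trans (n<1+n _) 2+k<n)

  a≡1+k : toℕ a ≡ suc (toℕ k)
  a≡1+k = toℕ-fromℕ< _

  a<p : toℕ a < toℕ p
  a<p = subst₂ _<_ (sym a≡1+k) (sym (toℕ-fromℕ< 2+k<n)) ≤-refl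

  a≢k : toℕ a ≢ toℕ k
  a≢k a≡k = 1+n≢n (trans (sym a≡1+k) a≡k)

  v : Vertex n
  v = flipBit p 𝟎

  image-adjacent : Adj (flipBit k 𝟎) (flipBit k v)
  image-adjacent = preserves 𝟎 v .proj₁ (p , 𝟎-adjAt-flipBit p)

  x : Fin n
  x = proj₁ image-adjacent

  adj : AdjAt (flipBit k 𝟎) (flipBit k v) x
  adj = proj₂ image-adjacent

  x≡p : toℕ x ≡ toℕ p
  x≡p = adjAt-index p x (λ j j≢p → flipBit-cong k j (flipBit-other p j 𝟎 j≢p)) adj

  m<x/2 : m < toℕ x / 2
  m<x/2 = ≤-reflexive (sym (begin
    toℕ x / 2             ≡⟨ cong (_/ 2) (trans x≡p (toℕ-fromℕ< 2+k<n)) ⟩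
    suc (suc (toℕ k)) / 2 ≡⟨ cong (λ z → suc (suc z) / 2) k≡2m ⟩
    suc (suc (2 * m)) / 2 ≡⟨ [2+2m]/2≡1+m m ⟩
    suc m                 ∎))
    where open ≡-Reasoning

  φv[a]≡true : flipBit k v a ≡ true
  φv[a]≡true = pairRel-01 (flipBit-other k a 𝟎 a≢k) (flipBit-self k 𝟎)
                 (adj .proj₂ .proj₂ .proj₂ m m<x/2 a k (trans a≡1+k (cong suc k≡2m)) k≡2m)

  φv[a]≡false : flipBit k v a ≡ false
  φv[a]≡false = trans (flipBit-other k a v a≢k) (flipBit-other p a 𝟎 (<⇒≢ a<p))

k<n≤2+k⇒k≡n∸2⊎k≡n∸1 : ∀ {k n} → k < n → n ≤ 2 + k → k ≡ n ∸ 2 ⊎ k ≡ n ∸ 1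
k<n≤2+k⇒k≡n∸2⊎k≡n∸1 k<n n≤2+k with m≤n⇒m<n∨m≡n n≤2+k
... | inj₁ n<2+k = inj₂ (cong (_∸ 1) (≤-antisym k<n (m<1+n⇒m≤n n<2+k)))
... | inj₂ n≡2+k = inj₁ (cong (_∸ 2) (sym n≡2+k))

lemma7 : (n : ℕ) → 2 ≤ n → (k : Fin n) → Even (toℕ k) →
    IsAutomorphism (flipBit k) →
    toℕ k ≡ n ∸ 2 ⊎ toℕ k ≡ n ∸ 1
lemma7 n _ k k-even automorphism with 2 + toℕ k <? n
... | yes 2+k<n = contradiction automorphism (flipBit-even-¬automorphism k k-even 2+k<n)
... | no  2+k≮n = k<n≤2+k⇒k≡n∸2⊎k≡n∸1 (toℕ<n k) (≮⇒≥ 2+k≮n)
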